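{- Let $T$ be an SN polytree with vertex set $V$. Define relations on $V$: $u<'_{\mathrm W}v$ iff there is an edge between $u$ and $v$ directed from $v$ to $u$; for such an edge, $u<'_{\mathrm S}v$ if its label is $\mathsf S$ and $v<'_{\mathrm S}u$ if its label is $\mathsf N$. Let $<_{\mathrm W},<_{\mathrm S}$ be their transitive closures. Then $(V,<_{\mathrm W},<_{\mathrm S})$ is a twin tree double poset, and the map $T\mapsto(V,<_{\mathrm W},<_{\mathrm S})$ is a bijection from (isomorphism classes of) SN polytrees to (isomorphism classes of) twin tree double posets.
   Context: A polytree is a finite directed graph whose underlying undirected graph is a tree. An SN polytree is a polytree each of whose edges is labeled $\mathsf S$ or $\mathsf N$. A finite strict double poset is a triple $(A,P,Q)$ of a finite set with two strict partial orders. Its Hasse diagrams are the cover relations of $P$ and of $Q$. It is a twin double poset if its two Hasse diagrams coincide as vertex-labeled undirected graphs, a tree double poset if both Hasse diagrams are trees as undirected graphs, and a twin tree double poset if it is both. -}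

module Defs where

open import Level using (0ℓ)
open import Data.Nat using (ℕ; suc; _≤_)
open import Data.Fin using (Fin)
open import Data.Maybe using (Maybe; just; nothing; Is-just)
open import Data.List using (List; []; _∷_; length; _∷ʳ_)
open import Data.List.Relation.Unary.Unique.Propositional using (Unique)
open import Data.List.Relation.Unary.Linked using (Linked)
open import Data.Product using (Σ; _×_; _,_; ∃)
open import Data.Sum using (_⊎_)
open import Relation.Nullary using (¬_)
open import Relation.Binary using (Rel; IsStrictPartialOrder)
open import Relation.Binary.PropositionalEquality using (_≡_)
open import Relation.Binary.Construct.Closure.ReflexiveTransitive using (Star)
open import Relation.Binary.Construct.Closure.Transitive using (TransClosure)
open import Function.Bundles using (_↔_; Inverse; _⇔_)

-- A cycle x, y₁, …, yₖ, x with k ≥ 2 (so at least 3 distinct vertices),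
-- consecutive vertices adjacent.
IsCycle : {n : ℕ} → Rel (Fin n) 0ℓ → Fin n → List (Fin n) → Set
IsCycle Adj x ys =
  2 ≤ length ys × Unique (x ∷ ys) × Linked Adj ((x ∷ ys) ∷ʳ x)

IsTree : (n : ℕ) → Rel (Fin n) 0ℓ → Set
IsTree n Adj =
  Fin n
  × (∀ u → ¬ Adj u u)
  × (∀ u v → Star Adj u v)
  × (∀ x ys → ¬ IsCycle Adj x ys)

data Label : Set where
  S N : Label

-- Underlying undirected graph of a directed graph given by
-- edge u v = just ℓ  iff there is an edge from u to v with label ℓ.
UAdj : {n : ℕ} → (Fin n → Fin n → Maybe Label) → Rel (Fin n) 0ℓ
UAdj edge u v = Is-just (edge u v) ⊎ Is-just (edge v u)

record SNPolytree : Set where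
  field
    n    : ℕ
    edge : Fin n → Fin n → Maybe Label
    -- no pair of antiparallel edges (they would form a double edge
    -- in the underlying undirected multigraph, which is then not a tree)
    noAntiparallel : ∀ u v → ¬ (Is-just (edge u v) × Is-just (edge v u))
    isTree : IsTree n (UAdj edge)

_≅ᵀ_ : SNPolytree → SNPolytree → Set
T ≅ᵀ T' = Σ (Fin (SNPolytree.n T) ↔ Fin (SNPolytree.n T')) λ f →
  ∀ u v → SNPolytree.edge T u v ≡ SNPolytree.edge T' (Inverse.to f u) (Inverse.to f v)

record Triple : Set₁ where
  field
    n   : ℕ
    _<P_ : Rel (Fin n) 0ℓ
    _<Q_ : Rel (Fin n) 0ℓ

IsDoublePoset : Triple → Set
IsDoublePoset D = IsStrictPartialOrder _≡_ (Triple._<P_ D)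
                × IsStrictPartialOrder _≡_ (Triple._<Q_ D)

Cover : {n : ℕ} → Rel (Fin n) 0ℓ → Rel (Fin n) 0ℓ
Cover _<_ u v = u < v × (∀ w → ¬ (u < w × w < v))

HasseAdj : {n : ℕ} → Rel (Fin n) 0ℓ → Rel (Fin n) 0ℓ
HasseAdj _<_ u v = Cover _<_ u v ⊎ Cover _<_ v u

IsTwin : Triple → Set
IsTwin D = ∀ u v → HasseAdj (Triple._<P_ D) u v ⇔ HasseAdj (Triple._<Q_ D) u v

IsTreeDP : Triple → Set
IsTreeDP D = IsTree (Triple.n D) (HasseAdj (Triple._<P_ D))
           × IsTree (Triple.n D) (HasseAdj (Triple._<Q_ D))

IsTwinTreeDoublePoset : Triple → Set
IsTwinTreeDoublePoset D = IsDoublePoset D × IsTwin D × IsTreeDP D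

_≅ᴰ_ : Triple → Triple → Set
D ≅ᴰ D' = Σ (Fin (Triple.n D) ↔ Fin (Triple.n D')) λ f →
  ∀ u v → (Triple._<P_ D u v ⇔ Triple._<P_ D' (Inverse.to f u) (Inverse.to f v))
        × (Triple._<Q_ D u v ⇔ Triple._<Q_ D' (Inverse.to f u) (Inverse.to f v))

W' : (T : SNPolytree) → Rel (Fin (SNPolytree.n T)) 0ℓ
W' T u v = Is-just (SNPolytree.edge T v u)

S' : (T : SNPolytree) → Rel (Fin (SNPolytree.n T)) 0ℓ
S' T u v = SNPolytree.edge T v u ≡ just S ⊎ SNPolytree.edge T u v ≡ just N

toDP : SNPolytree → Triple
toDP T = record
  { n    = SNPolytree.n T
  ; _<P_ = TransClosure (W' T)
  ; _<Q_ = TransClosure (S' T)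
  }

-- In a polytree, W′ and S′ each orient every edge of the underlying tree in exactly one
-- direction.  Loop erasure turns a directed walk into a simple path, and in a tree a simple
-- path with at least two vertices cannot be closed up by an edge; hence the transitive
-- closure of such an orientation is irreflexive and its covers are exactly the oriented
-- edges.  So both Hasse diagrams are the underlying tree, and conversely W′ and S′, and with
-- them the labelled edges, are recovered from the two orders.  For surjectivity, a finite
-- strict order is the transitive closure of its covers (well-founded induction both ways),
-- so a twin tree double poset comes from the polytree whose edges are its P-covers, labelled
-- S where Q agrees with P and N where it disagrees.

{-# OPTIONS --safe #-}
module Submission where

open import Defs
open import Data.Product using (Σ; _×_)
open import Relation.Binary using (Decidable)

open import Level using (0ℓ)
open import Function.Base using (flip)
open import Function.Bundles using (_↔_; Inverse; _⇔_; mk⇔; Equivalence)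
open import Function.Construct.Composition using (_⇔-∘_)
open import Function.Construct.Identity using (↔-id; ⇔-id)
open import Function.Construct.Symmetry using (⇔-sym)
open import Data.Empty using (⊥-elim)
open import Data.Unit using (tt)
open import Data.Product using (_,_; proj₁; proj₂; ∃)
open import Data.Product.Function.NonDependent.Propositional using (_×-⇔_)
open import Data.Sum using (_⊎_; inj₁; inj₂; swap)
open import Data.Sum.Function.Propositional using (_⊎-⇔_)
open import Data.Nat using (ℕ; z≤n; s≤s)
open import Data.Fin using (Fin)
open import Data.Fin.Properties using (any?; all?) renaming (_≟_ to _≟ᶠ_)
open import Data.Fin.Induction using (spo-wellFounded; spo-noetherian)
open import Data.Maybe using (Maybe; just; nothing; Is-just)
open import Data.Maybe.Relation.Unary.Any using (just)
open import Data.List using (List; []; _∷_; _∷ʳ_)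
open import Data.List.Relation.Unary.All using ([]; _∷_)
open import Data.List.Relation.Unary.All.Properties using (¬Any⇒All¬)
open import Data.List.Relation.Unary.AllPairs using ([]; _∷_)
open import Data.List.Relation.Unary.Any using (here; there)
open import Data.List.Relation.Unary.Unique.Propositional using (Unique)
open import Data.List.Relation.Unary.Linked as Linked using (Linked; [-]; _∷_)
open import Data.List.Membership.Propositional using (_∈_; _∉_)
import Data.List.Membership.DecPropositional as DecMembership
open import Induction.WellFounded using (Acc; acc)
open import Relation.Nullary using (¬_; Dec; yes; no; contradiction)
open import Relation.Nullary.Decidable using (_×-dec_; ¬?)
open import Relation.Binary using (Rel; _⇒_; _=[_]⇒_; Symmetric; Asymmetric; DecidableEquality; IsStrictPartialOrder)
open import Relation.Binary.PropositionalEquality using (_≡_; refl; sym; trans; subst; subst₂; resp₂; isEquivalence; ≢-sym)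
open import Relation.Binary.Construct.Closure.ReflexiveTransitive as Star using (Star; ε; _◅_; _◅◅_)
open import Relation.Binary.Construct.Closure.Transitive using (TransClosure; [_]; _∷_; _++_; transitive⁻; equivalent; map)

open Equivalence using (to; from)

module _ {A : Set} {R : Rel A 0ℓ} where

  TransClosure⇒Star : TransClosure R ⇒ Star R
  TransClosure⇒Star [ r ]   = r ◅ ε
  TransClosure⇒Star (r ∷ t) = r ◅ TransClosure⇒Star t

  TransClosure-uncons : ∀ {x z} → TransClosure R x z → ∃ λ y → R x y × Star R y z
  TransClosure-uncons [ r ]   = _ , r , ε
  TransClosure-uncons (r ∷ t) = _ , r , TransClosure⇒Star t

  _◅⁺_ : ∀ {x y z} → R x y → Star R y z → TransClosure R x z
  r ◅⁺ ε        = [ r ]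
  r ◅⁺ (r′ ◅ s) = r ∷ (r′ ◅⁺ s)

  _◅◅⁺_ : ∀ {x y z} → Star R x y → TransClosure R y z → TransClosure R x z
  ε       ◅◅⁺ t = t
  (r ◅ s) ◅◅⁺ t = r ∷ (s ◅◅⁺ t)

TransClosure-gmap : ∀ {A B : Set} {R : Rel A 0ℓ} {R′ : Rel B 0ℓ} {f : A → B} →
                    R =[ f ]⇒ R′ → TransClosure R =[ f ]⇒ TransClosure R′
TransClosure-gmap h t = to equivalent (map h (from equivalent t))

-- The list vs records the vertices of the path except its endpoint b.
data SimplePath {A : Set} (E : Rel A 0ℓ) : A → A → List A → Set where
  []   : ∀ {b} → SimplePath E b b []
  step : ∀ {a c b vs} → E a c → SimplePath E c b vs → a ∉ b ∷ vs → SimplePath E a b (a ∷ vs)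

module _ {A : Set} {E : Rel A 0ℓ} where

  SimplePath-map : ∀ {E′ : Rel A 0ℓ} → E ⇒ E′ → ∀ {a b vs} → SimplePath E a b vs → SimplePath E′ a b vs
  SimplePath-map h []           = []
  SimplePath-map h (step e p a∉) = step (h e) (SimplePath-map h p) a∉

  SimplePath-unique : ∀ {a b vs} → SimplePath E a b vs → Unique (b ∷ vs)
  SimplePath-unique []            = [] ∷ []
  SimplePath-unique (step _ p a∉) with SimplePath-unique p | ¬Any⇒All¬ _ a∉
  ... | b∉vs ∷ vs-unique | a≢b ∷ a∉vs = (≢-sym a≢b ∷ b∉vs) ∷ a∉vs ∷ vs-unique

  SimplePath-linked : ∀ {x a b vs} → E x a → SimplePath E a b vs → Linked E (x ∷ vs ∷ʳ b)
  SimplePath-linked e []            = e ∷ [-]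
  SimplePath-linked e (step e′ p _) = e ∷ SimplePath-linked e′ p

  ∈-SimplePath⇒Star : ∀ {a b vs x} → SimplePath E a b vs → x ∈ vs → Star E a x
  ∈-SimplePath⇒Star (step _ _ _) (here refl) = ε
  ∈-SimplePath⇒Star (step e p _) (there i)   = e ◅ ∈-SimplePath⇒Star p i

  SimplePath-suffix : ∀ {a b vs x} → SimplePath E a b vs → x ∈ b ∷ vs → ∃ (SimplePath E x b)
  SimplePath-suffix _                (here refl)         = _ , []
  SimplePath-suffix p@(step _ _ _)   (there (here refl)) = _ , p
  SimplePath-suffix (step _ p _)     (there (there i))   = SimplePath-suffix p (there i)

  module _ (_≟_ : DecidableEquality A) where
    open DecMembership _≟_ using (_∈?_)

    Star⇒SimplePath : ∀ {a b} → Star E a b → ∃ (SimplePath E a b)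
    Star⇒SimplePath ε = _ , []
    Star⇒SimplePath {a} {b} (e ◅ s) with Star⇒SimplePath s
    ... | vs , p with a ∈? b ∷ vs
    ...   | yes a∈ = SimplePath-suffix p a∈
    ...   | no a∉  = _ , step e p a∉

module _ {n : ℕ} {Adj : Rel (Fin n) 0ℓ} (acyclic : ∀ x ys → ¬ IsCycle Adj x ys) where

  acyclic⇒¬closed-SimplePath : ∀ {x a c vs} → Adj x a → ¬ SimplePath Adj a x (a ∷ c ∷ vs)
  acyclic⇒¬closed-SimplePath e p =
    acyclic _ _ (s≤s (s≤s z≤n) , SimplePath-unique p , SimplePath-linked e p)

module Orientation {n : ℕ} {Adj R : Rel (Fin n) 0ℓ}
  (acyclic : ∀ x ys → ¬ IsCycle Adj x ys) (Adj-sym : Symmetric Adj)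
  (R⇒Adj : R ⇒ Adj) (R-asym : Asymmetric R) where

  private
    simplePath : ∀ {a b} → Star R a b → ∃ (SimplePath R a b)
    simplePath = Star⇒SimplePath _≟ᶠ_

  R-irrefl : ∀ {x} → ¬ R x x
  R-irrefl r = R-asym r r

  TransClosure-irrefl : ∀ {x} → ¬ TransClosure R x x
  TransClosure-irrefl t with TransClosure-uncons t
  ... | a , r , s with simplePath s
  ...   | _ , []                        = R-irrefl r
  ...   | _ , step r′ [] _              = R-asym r r′
  ...   | _ , p@(step _ (step _ _ _) _) =
    acyclic⇒¬closed-SimplePath acyclic (R⇒Adj r) (SimplePath-map R⇒Adj p)

  TransClosure-isStrictPartialOrder : IsStrictPartialOrder _≡_ (TransClosure R)
  TransClosure-isStrictPartialOrder = record
    { isEquivalence = isEquivalence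
    ; irrefl        = λ { refl → TransClosure-irrefl }
    ; trans         = _++_
    ; <-resp-≈      = resp₂ (TransClosure R)
    }

  -- A detour u →⁺ w →⁺ v, loop-erased, would close a cycle with the edge v — u.
  R⇒Cover : ∀ {u v} → R u v → Cover (TransClosure R) u v
  R⇒Cover {u} {v} r = [ r ] , no-detour
    where
    no-detour : ∀ w → ¬ (TransClosure R u w × TransClosure R w v)
    no-detour w (t₁ , t₂) with TransClosure-uncons t₁
    ... | a , r₁ , s with simplePath (s ◅◅ TransClosure⇒Star t₂)
    ...   | _ , []             = TransClosure-irrefl (s ◅◅⁺ t₂)
    ...   | _ , p@(step _ _ _) =
      acyclic⇒¬closed-SimplePath acyclic (Adj-sym (R⇒Adj r))
        (step (R⇒Adj r₁) (SimplePath-map R⇒Adj p) u∉)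
      where
      u∉ : u ∉ v ∷ _
      u∉ (here refl) = R-irrefl r
      u∉ (there i)   = TransClosure-irrefl (r₁ ◅⁺ ∈-SimplePath⇒Star p i)

  Cover⇒R : ∀ {u v} → Cover (TransClosure R) u v → R u v
  Cover⇒R ([ r ]   , _)         = r
  Cover⇒R ((r ∷ t) , no-detour) = ⊥-elim (no-detour _ ([ r ] , t))

  Cover⇔R : ∀ {u v} → Cover (TransClosure R) u v ⇔ R u v
  Cover⇔R = mk⇔ Cover⇒R R⇒Cover

  HasseAdj⇔R⊎R⁻¹ : ∀ {u v} → HasseAdj (TransClosure R) u v ⇔ (R u v ⊎ R v u)
  HasseAdj⇔R⊎R⁻¹ = Cover⇔R ⊎-⇔ Cover⇔R

≡just⇒Is-just : ∀ {A : Set} {m : Maybe A} {x : A} → m ≡ just x → Is-just m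
≡just⇒Is-just refl = just tt

Is-just⇒≡S⊎≡N : ∀ {m : Maybe Label} → Is-just m → m ≡ just S ⊎ m ≡ just N
Is-just⇒≡S⊎≡N {just S} _ = inj₁ refl
Is-just⇒≡S⊎≡N {just N} _ = inj₂ refl

Maybe-Label-≡ : ∀ {m m′ : Maybe Label} →
                (Is-just m ⇔ Is-just m′) → (m ≡ just S ⇔ m′ ≡ just S) → m ≡ m′
Maybe-Label-≡ {nothing} {nothing} _ _ = refl
Maybe-Label-≡ {nothing} {just _}  j _ = contradiction (from j (just tt)) λ ()
Maybe-Label-≡ {just _}  {nothing} j _ = contradiction (to j (just tt)) λ ()
Maybe-Label-≡ {just S}  {just S}  _ _ = refl
Maybe-Label-≡ {just S}  {just N}  _ s = contradiction (to s refl) λ ()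
Maybe-Label-≡ {just N}  {just S}  _ s = contradiction (from s refl) λ ()
Maybe-Label-≡ {just N}  {just N}  _ _ = refl

IsTree-resp-⇔ : ∀ {n} {Adj Adj′ : Rel (Fin n) 0ℓ} →
                (∀ {u v} → Adj u v ⇔ Adj′ u v) → IsTree n Adj → IsTree n Adj′
IsTree-resp-⇔ h (x , irrefl , connected , acyclic) =
  x ,
  (λ u a → irrefl u (from h a)) ,
  (λ u v → Star.map (to h) (connected u v)) ,
  (λ x ys (long , unique , linked) → acyclic x ys (long , unique , Linked.map (from h) linked))

module Polytree (T : SNPolytree) where
  open SNPolytree T

  acyclic : ∀ x ys → ¬ IsCycle (UAdj edge) x ys
  acyclic = proj₂ (proj₂ (proj₂ isTree))

  UAdj-sym : Symmetric (UAdj edge)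
  UAdj-sym = swap

  W′-asym : Asymmetric (W' T)
  W′-asym {u} {v} w w′ = noAntiparallel u v (w′ , w)

  UAdj⇔W′⊎W′⁻¹ : ∀ {u v} → UAdj edge u v ⇔ (W' T u v ⊎ W' T v u)
  UAdj⇔W′⊎W′⁻¹ = mk⇔ swap swap

  S′⇒UAdj : S' T ⇒ UAdj edge
  S′⇒UAdj (inj₁ vu≡S) = inj₂ (≡just⇒Is-just vu≡S)
  S′⇒UAdj (inj₂ uv≡N) = inj₁ (≡just⇒Is-just uv≡N)

  S′-asym : Asymmetric (S' T)
  S′-asym {u} {v} (inj₁ vu≡S) (inj₁ uv≡S) = noAntiparallel u v (≡just⇒Is-just uv≡S , ≡just⇒Is-just vu≡S)
  S′-asym         (inj₁ vu≡S) (inj₂ vu≡N) = contradiction (trans (sym vu≡S) vu≡N) λ ()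
  S′-asym         (inj₂ uv≡N) (inj₁ uv≡S) = contradiction (trans (sym uv≡S) uv≡N) λ ()
  S′-asym {u} {v} (inj₂ uv≡N) (inj₂ vu≡N) = noAntiparallel u v (≡just⇒Is-just uv≡N , ≡just⇒Is-just vu≡N)

  UAdj⇒S′⊎S′⁻¹ : ∀ {u v} → UAdj edge u v → S' T u v ⊎ S' T v u
  UAdj⇒S′⊎S′⁻¹ (inj₁ j) with Is-just⇒≡S⊎≡N j
  ... | inj₁ uv≡S = inj₂ (inj₁ uv≡S)
  ... | inj₂ uv≡N = inj₁ (inj₂ uv≡N)
  UAdj⇒S′⊎S′⁻¹ (inj₂ j) with Is-just⇒≡S⊎≡N j
  ... | inj₁ vu≡S = inj₁ (inj₁ vu≡S)
  ... | inj₂ vu≡N = inj₂ (inj₂ vu≡N)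

  UAdj⇔S′⊎S′⁻¹ : ∀ {u v} → UAdj edge u v ⇔ (S' T u v ⊎ S' T v u)
  UAdj⇔S′⊎S′⁻¹ = mk⇔ UAdj⇒S′⊎S′⁻¹ λ { (inj₁ s) → S′⇒UAdj s ; (inj₂ s) → UAdj-sym (S′⇒UAdj s) }

  module <W = Orientation acyclic UAdj-sym inj₂ W′-asym
  module <S = Orientation acyclic UAdj-sym S′⇒UAdj S′-asym

  HasseAdj-W⇔UAdj : ∀ {u v} → HasseAdj (TransClosure (W' T)) u v ⇔ UAdj edge u v
  HasseAdj-W⇔UAdj = ⇔-sym UAdj⇔W′⊎W′⁻¹ ⇔-∘ <W.HasseAdj⇔R⊎R⁻¹

  HasseAdj-S⇔UAdj : ∀ {u v} → HasseAdj (TransClosure (S' T)) u v ⇔ UAdj edge u v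
  HasseAdj-S⇔UAdj = ⇔-sym UAdj⇔S′⊎S′⁻¹ ⇔-∘ <S.HasseAdj⇔R⊎R⁻¹

  toDP-isTwinTreeDoublePoset : IsTwinTreeDoublePoset (toDP T)
  toDP-isTwinTreeDoublePoset =
    (<W.TransClosure-isStrictPartialOrder , <S.TransClosure-isStrictPartialOrder) ,
    (λ u v → ⇔-sym HasseAdj-S⇔UAdj ⇔-∘ HasseAdj-W⇔UAdj) ,
    IsTree-resp-⇔ (⇔-sym HasseAdj-W⇔UAdj) isTree ,
    IsTree-resp-⇔ (⇔-sym HasseAdj-S⇔UAdj) isTree

  edge≡S⇔W′×S′ : ∀ {u v} → edge u v ≡ just S ⇔ (W' T v u × S' T v u)
  edge≡S⇔W′×S′ {u} {v} = mk⇔ (λ uv≡S → ≡just⇒Is-just uv≡S , inj₁ uv≡S) λ where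
    (_ , inj₁ uv≡S) → uv≡S
    (w , inj₂ vu≡N) → contradiction (w , ≡just⇒Is-just vu≡N) (noAntiparallel u v)

_=[_]⇔_ : ∀ {A B : Set} → Rel A 0ℓ → A ↔ B → Rel B 0ℓ → Set
R =[ f ]⇔ R′ = ∀ u v → R u v ⇔ R′ (Inverse.to f u) (Inverse.to f v)

module _ {n m : ℕ} (f : Fin n ↔ Fin m) {R : Rel (Fin n) 0ℓ} {R′ : Rel (Fin m) 0ℓ} (h : R =[ f ]⇔ R′) where
  private
    module f = Inverse f

    to-from : ∀ y → y ≡ f.to (f.from y)
    to-from y = sym (f.strictlyInverseˡ y)

    from-preserves : R′ =[ f.from ]⇒ R
    from-preserves {x} {y} r = from (h _ _) (subst₂ R′ (to-from x) (to-from y) r)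

  TransClosure-=[]⇔ : TransClosure R =[ f ]⇔ TransClosure R′
  TransClosure-=[]⇔ u v = mk⇔ (TransClosure-gmap (to (h _ _))) λ t →
    subst₂ (TransClosure R) (f.strictlyInverseʳ u) (f.strictlyInverseʳ v) (TransClosure-gmap from-preserves t)

  Cover-=[]⇔ : Cover R =[ f ]⇔ Cover R′
  Cover-=[]⇔ u v = mk⇔
    (λ (r , no-detour) → to (h u v) r , λ w (r₁ , r₂) → no-detour (f.from w)
      ( from (h u (f.from w)) (subst (R′ (f.to u)) (to-from w) r₁)
      , from (h (f.from w) v) (subst (λ z → R′ z (f.to v)) (to-from w) r₂)))
    (λ (r , no-detour) → from (h u v) r , λ w (r₁ , r₂) → no-detour (f.to w)
      (to (h u w) r₁ , to (h w v) r₂))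

toDP-resp-≅ : (T T′ : SNPolytree) → T ≅ᵀ T′ → toDP T ≅ᴰ toDP T′
toDP-resp-≅ T T′ (f , edge≡) = f , λ u v →
  TransClosure-=[]⇔ f W′⇔ u v , TransClosure-=[]⇔ f S′⇔ u v
  where
  W′⇔ : W' T =[ f ]⇔ W' T′
  W′⇔ u v rewrite edge≡ v u = ⇔-id _
  S′⇔ : S' T =[ f ]⇔ S' T′
  S′⇔ u v rewrite edge≡ v u | edge≡ u v = ⇔-id _

toDP-reflects-≅ : (T T′ : SNPolytree) → toDP T ≅ᴰ toDP T′ → T ≅ᵀ T′
toDP-reflects-≅ T T′ (f , <⇔) = f , λ u v →
  Maybe-Label-≡ (W′⇔ v u) (⇔-sym T′.edge≡S⇔W′×S′ ⇔-∘ ((W′⇔ v u ×-⇔ S′⇔ v u) ⇔-∘ T.edge≡S⇔W′×S′))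
  where
  module T = Polytree T
  module T′ = Polytree T′

  covers-=[]⇔ : ∀ {R : Rel (Fin (SNPolytree.n T)) 0ℓ} {R′ : Rel (Fin (SNPolytree.n T′)) 0ℓ} →
                (∀ {u v} → Cover (TransClosure R) u v ⇔ R u v) →
                (∀ {u v} → Cover (TransClosure R′) u v ⇔ R′ u v) →
                TransClosure R =[ f ]⇔ TransClosure R′ → R =[ f ]⇔ R′
  covers-=[]⇔ {R′ = R′} R-covers R′-covers h u v =
    R′-covers ⇔-∘ (Cover-=[]⇔ f {R′ = TransClosure R′} h u v ⇔-∘ ⇔-sym R-covers)

  W′⇔ : W' T =[ f ]⇔ W' T′
  W′⇔ = covers-=[]⇔ T.<W.Cover⇔R T′.<W.Cover⇔R (λ u v → proj₁ (<⇔ u v))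

  S′⇔ : S' T =[ f ]⇔ S' T′
  S′⇔ = covers-=[]⇔ T.<S.Cover⇔R T′.<S.Cover⇔R (λ u v → proj₂ (<⇔ u v))

module FinitePoset {n : ℕ} {_<_ : Rel (Fin n) 0ℓ}
  (_<?_ : Decidable _<_) (spo : IsStrictPartialOrder _≡_ _<_) where
  open IsStrictPartialOrder spo using () renaming (trans to <-trans)

  Cover? : Decidable (Cover _<_)
  Cover? u v = u <? v ×-dec all? (λ w → ¬? (u <? w ×-dec w <? v))

  Cover⊎between : ∀ {u v} → u < v → Cover _<_ u v ⊎ ∃ λ w → u < w × w < v
  Cover⊎between {u} {v} u<v with any? (λ w → u <? w ×-dec w <? v)
  ... | yes between = inj₂ between
  ... | no ¬between = inj₁ (u<v , λ w u<w<v → ¬between (w , u<w<v))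

  covered-below : ∀ {u w} → Acc _<_ w → u < w → ∃ λ c → Cover _<_ u c × (c ≡ w ⊎ c < w)
  covered-below (acc below) u<w with Cover⊎between u<w
  ... | inj₁ u⋖w = _ , u⋖w , inj₁ refl
  ... | inj₂ (w′ , u<w′ , w′<w) with covered-below (below w′<w) u<w′
  ...   | c , u⋖c , inj₁ refl  = c , u⋖c , inj₂ w′<w
  ...   | c , u⋖c , inj₂ c<w′  = c , u⋖c , inj₂ (<-trans c<w′ w′<w)

  <⇒Cover⁺ : ∀ {u v} → Acc (flip _<_) u → u < v → TransClosure (Cover _<_) u v
  <⇒Cover⁺ (acc above) u<v with covered-below (spo-wellFounded spo _) u<v
  ... | _ , u⋖v , inj₁ refl = [ u⋖v ]
  ... | _ , u⋖c , inj₂ c<v  = u⋖c ∷ <⇒Cover⁺ (above (proj₁ u⋖c)) c<v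

  <⇔Cover⁺ : ∀ {u v} → u < v ⇔ TransClosure (Cover _<_) u v
  <⇔Cover⁺ = mk⇔ (<⇒Cover⁺ (spo-noetherian spo _)) λ t → transitive⁻ _<_ <-trans (TransClosure-gmap proj₁ t)

orientedEdge : ∀ {C X : Set} → Dec C → Dec X → Maybe Label
orientedEdge (yes _) (yes _) = just S
orientedEdge (yes _) (no _)  = just N
orientedEdge (no _)  _       = nothing

module _ {C X : Set} where

  orientedEdge-Is-just : (c? : Dec C) (x? : Dec X) → Is-just (orientedEdge c? x?) ⇔ C
  orientedEdge-Is-just (yes c) (yes _) = mk⇔ (λ _ → c) (λ _ → just tt)
  orientedEdge-Is-just (yes c) (no _)  = mk⇔ (λ _ → c) (λ _ → just tt)
  orientedEdge-Is-just (no ¬c) _       = mk⇔ (λ ()) (λ c → contradiction c ¬c)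

  orientedEdge≡S : (c? : Dec C) (x? : Dec X) → orientedEdge c? x? ≡ just S ⇔ (C × X)
  orientedEdge≡S (yes c) (yes x) = mk⇔ (λ _ → c , x) (λ _ → refl)
  orientedEdge≡S (yes _) (no ¬x) = mk⇔ (λ ()) (λ (_ , x) → contradiction x ¬x)
  orientedEdge≡S (no ¬c) _       = mk⇔ (λ ()) (λ (c , _) → contradiction c ¬c)

  orientedEdge≡N : (c? : Dec C) (x? : Dec X) → orientedEdge c? x? ≡ just N ⇔ (C × ¬ X)
  orientedEdge≡N (yes _) (yes x) = mk⇔ (λ ()) (λ (_ , ¬x) → contradiction x ¬x)
  orientedEdge≡N (yes c) (no ¬x) = mk⇔ (λ _ → c , ¬x) (λ _ → refl)
  orientedEdge≡N (no ¬c) _       = mk⇔ (λ ()) (λ (c , _) → contradiction c ¬c)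

module TwinDoublePoset (D : Triple) (isDoublePoset : IsDoublePoset D) (twin : IsTwin D) where
  open Triple D
  open IsStrictPartialOrder (proj₂ isDoublePoset) using () renaming (asym to <Q-asym)

  HasseAdj-Q⇒Cover : ∀ {u v} → HasseAdj _<Q_ u v → ¬ v <Q u → Cover _<Q_ u v
  HasseAdj-Q⇒Cover (inj₁ u⋖v) _   = u⋖v
  HasseAdj-Q⇒Cover (inj₂ v⋖u) v≮u = contradiction (proj₁ v⋖u) v≮u

  Cover-Q⇔Cover-P⊎Cover-P⁻¹ : ∀ {u v} →
    Cover _<Q_ u v ⇔ (Cover _<P_ u v × u <Q v ⊎ Cover _<P_ v u × ¬ v <Q u)
  Cover-Q⇔Cover-P⊎Cover-P⁻¹ {u} {v} = mk⇔ split join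
    where
    split : Cover _<Q_ u v → Cover _<P_ u v × u <Q v ⊎ Cover _<P_ v u × ¬ v <Q u
    split u⋖v with from (twin u v) (inj₁ u⋖v)
    ... | inj₁ u⋖ᴾv = inj₁ (u⋖ᴾv , proj₁ u⋖v)
    ... | inj₂ v⋖ᴾu = inj₂ (v⋖ᴾu , <Q-asym (proj₁ u⋖v))
    join : Cover _<P_ u v × u <Q v ⊎ Cover _<P_ v u × ¬ v <Q u → Cover _<Q_ u v
    join (inj₁ (u⋖v , u<v)) = HasseAdj-Q⇒Cover (to (twin u v) (inj₁ u⋖v)) (<Q-asym u<v)
    join (inj₂ (v⋖u , v≮u)) = HasseAdj-Q⇒Cover (to (twin u v) (inj₂ v⋖u)) v≮u

toDP-surjective : (D : Triple) → Decidable (Triple._<P_ D) → Decidable (Triple._<Q_ D) →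
                  IsTwinTreeDoublePoset D → Σ SNPolytree λ T → D ≅ᴰ toDP T
toDP-surjective D _<P?_ _<Q?_ (isDP@(P-spo , Q-spo) , twin , P-tree , _) =
  T , ↔-id _ , λ u v → <P⇔ u v , <Q⇔ u v
  where
  open Triple D
  open TwinDoublePoset D isDP twin
  open IsStrictPartialOrder P-spo using () renaming (asym to <P-asym)
  module P = FinitePoset _<P?_ P-spo
  module Q = FinitePoset _<Q?_ Q-spo

  edge : Fin n → Fin n → Maybe Label
  edge a b = orientedEdge (P.Cover? b a) (b <Q? a)

  Is-just⇔Cover-P : ∀ {a b} → Is-just (edge a b) ⇔ Cover _<P_ b a
  Is-just⇔Cover-P {a} {b} = orientedEdge-Is-just (P.Cover? b a) (b <Q? a)

  noAntiparallel : ∀ u v → ¬ (Is-just (edge u v) × Is-just (edge v u))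
  noAntiparallel u v (uv , vu) = <P-asym (proj₁ (to Is-just⇔Cover-P uv)) (proj₁ (to Is-just⇔Cover-P vu))

  UAdj⇔HasseAdj-P : ∀ {u v} → UAdj edge u v ⇔ HasseAdj _<P_ u v
  UAdj⇔HasseAdj-P = mk⇔ swap swap ⇔-∘ (Is-just⇔Cover-P ⊎-⇔ Is-just⇔Cover-P)

  T : SNPolytree
  T = record
    { n              = n
    ; edge           = edge
    ; noAntiparallel = noAntiparallel
    ; isTree         = IsTree-resp-⇔ (⇔-sym UAdj⇔HasseAdj-P) P-tree
    }

  S′⇔Cover-Q : ∀ {u v} → S' T u v ⇔ Cover _<Q_ u v
  S′⇔Cover-Q {u} {v} =
    ⇔-sym Cover-Q⇔Cover-P⊎Cover-P⁻¹ ⇔-∘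
      (orientedEdge≡S (P.Cover? u v) (u <Q? v) ⊎-⇔ orientedEdge≡N (P.Cover? v u) (v <Q? u))

  <P⇔ : _<P_ =[ ↔-id _ ]⇔ TransClosure (W' T)
  <P⇔ u v = TransClosure-=[]⇔ (↔-id _) (λ _ _ → ⇔-sym Is-just⇔Cover-P) u v ⇔-∘ P.<⇔Cover⁺

  <Q⇔ : _<Q_ =[ ↔-id _ ]⇔ TransClosure (S' T)
  <Q⇔ u v = TransClosure-=[]⇔ (↔-id _) (λ _ _ → ⇔-sym S′⇔Cover-Q) u v ⇔-∘ Q.<⇔Cover⁺

lemma2p11 :
  -- the construction lands in twin tree double posets
  ((T : SNPolytree) → IsTwinTreeDoublePoset (toDP T))
  -- it respects isomorphism (well defined on isomorphism classes)
  × ((T T' : SNPolytree) → T ≅ᵀ T' → toDP T ≅ᴰ toDP T')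
  -- injective on isomorphism classes
  × ((T T' : SNPolytree) → toDP T ≅ᴰ toDP T' → T ≅ᵀ T')
  -- surjective onto isomorphism classes of twin tree double posets
  × ((D : Triple) → Decidable (Triple._<P_ D) → Decidable (Triple._<Q_ D)
       → IsTwinTreeDoublePoset D → Σ SNPolytree λ T → D ≅ᴰ toDP T)
lemma2p11 = Polytree.toDP-isTwinTreeDoublePoset , toDP-resp-≅ , toDP-reflects-≅ , toDP-surjective
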